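{- Let $k$ be a positive integer, let $G_1,G_2$ be disjoint copies of $C_{3k}$ with $V(G_2)=\{v_1,\dots,v_{3k}\}$ labeled cyclically, and let $f:V(G_1)\to V(G_2)$ be a function. For $i\in\{1,2,3\}$ let $V_i=\{v_j: j\equiv i\pmod 3\}$. If for some $i$ the average degree in $C(C_{3k},f)$ over the vertices of $V_i$ is strictly greater than $4$, then $\gamma(C(C_{3k},f))<2\gamma(C_{3k})$.
   Context: For disjoint copies $G_1,G_2$ of a graph $G$ and a function $f:V(G_1)\to V(G_2)$, the functigraph $C(G,f)$ has vertex set $V(G_1)\cup V(G_2)$ and edge set $E(G_1)\cup E(G_2)\cup\{uv : u\in V(G_1), v\in V(G_2), v=f(u)\}$. $\gamma$ denotes domination number. -}

module Defs where

open import Data.Nat using (ℕ; zero; suc; _+_; _*_; _≤_; _<_; _%_)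
open import Data.Nat.Properties using (_≟_)
open import Data.Fin using (Fin; toℕ; splitAt; _↑ʳ_)
open import Data.Fin.Subset using (Subset; _∈_; ∣_∣)
open import Data.List using (List; length; filter; allFin; map)
open import Data.Nat.ListAction using (sum)
open import Data.Product using (Σ; _×_; _,_)
open import Data.Sum using (_⊎_; inj₁; inj₂)
open import Data.Empty using (⊥)
open import Relation.Binary.PropositionalEquality using (_≡_)
open import Relation.Nullary using (Dec; yes; no)
open import Relation.Nullary.Decidable using (_⊎-dec_; _×-dec_)
open import Relation.Binary using (Decidable)

record Graph : Set₁ where
  field
    n    : ℕ
    Adj  : Fin n → Fin n → Set
    adj? : Decidable Adj
open Graph public

deg : (G : Graph) → Fin (n G) → ℕ
deg G v = length (filter (adj? G v) (allFin (n G)))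

Dominating : (G : Graph) → Subset (n G) → Set
Dominating G D = ∀ v → (v ∈ D) ⊎ Σ (Fin (n G)) (λ u → (u ∈ D) × Adj G u v)

IsDominationNumber : Graph → ℕ → Set
IsDominationNumber G d =
  Σ (Subset (n G)) (λ D → Dominating G D × ∣ D ∣ ≡ d)
  × (∀ D → Dominating G D → d ≤ ∣ D ∣)

-- Cycle C_m on vertices 0,…,m-1 (vertex t stands for v_{t+1}); t adjacent to t+1 mod m.
CycSucc : (m : ℕ) → Fin m → Fin m → Set
CycSucc m u v = (suc (toℕ u) ≡ toℕ v) ⊎ ((suc (toℕ u) ≡ m) × (toℕ v ≡ 0))

cycSucc? : (m : ℕ) → Decidable (CycSucc m)
cycSucc? m u v = (suc (toℕ u) ≟ toℕ v) ⊎-dec ((suc (toℕ u) ≟ m) ×-dec (toℕ v ≟ 0))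

cycle : ℕ → Graph
cycle m = record
  { n = m
  ; Adj = λ u v → CycSucc m u v ⊎ CycSucc m v u
  ; adj? = λ u v → cycSucc? m u v ⊎-dec cycSucc? m v u }

-- Functigraph C(G,f): vertex set Fin (n + n); the first n vertices form G₁,
-- the last n form G₂ (vertex j of G₂ is  n ↑ʳ j).
FAdj : (G : Graph) → (Fin (n G) → Fin (n G)) → Fin (n G) ⊎ Fin (n G) → Fin (n G) ⊎ Fin (n G) → Set
FAdj G f (inj₁ a) (inj₁ b) = Adj G a b
FAdj G f (inj₂ a) (inj₂ b) = Adj G a b
FAdj G f (inj₁ u) (inj₂ v) = v ≡ f u
FAdj G f (inj₂ v) (inj₁ u) = v ≡ f u

fadj? : (G : Graph) → (f : Fin (n G) → Fin (n G)) → Decidable (FAdj G f)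
fadj? G f (inj₁ a) (inj₁ b) = adj? G a b
fadj? G f (inj₂ a) (inj₂ b) = adj? G a b
fadj? G f (inj₁ u) (inj₂ v) = Data.Fin._≟_ v (f u)
fadj? G f (inj₂ v) (inj₁ u) = Data.Fin._≟_ v (f u)

functigraph : (G : Graph) → (Fin (n G) → Fin (n G)) → Graph
functigraph G f = record
  { n = n G + n G
  ; Adj = λ x y → FAdj G f (splitAt (n G) x) (splitAt (n G) y)
  ; adj? = λ x y → fadj? G f (splitAt (n G) x) (splitAt (n G) y) }

-- The class V_i of G₂ = C_{3k}, as a list of 0-based indices t with t ≡ r (mod 3),
-- where r = i - 1 (so i ∈ {1,2,3} corresponds to r ∈ Fin 3).
Vclass : (k : ℕ) → Fin 3 → List (Fin (3 * k))
Vclass k r = filter (λ t → toℕ t % 3 ≟ toℕ r) (allFin (3 * k))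

degSumV : (k : ℕ) → (f : Fin (3 * k) → Fin (3 * k)) → Fin 3 → ℕ
degSumV k f r = sum (map (λ t → deg (functigraph (cycle (3 * k)) f) ((3 * k) ↑ʳ t)) (Vclass k r))

-- Let V be the residue class r of G₂ = C_{3k}; it dominates the cycle. In C(C_{3k}, f) a vertex t
-- of G₂ has degree 2 + |f⁻¹(t)|, so the degree hypothesis says that more than 2|V| vertices of G₁
-- are mapped into V. Then V, together with the vertices of G₁ mapped outside V, dominates
-- C(C_{3k}, f) and has 3k + |V| - |f⁻¹(V)| < 3k - |V| ≤ 2k elements. Finally every vertex of a
-- cycle dominates only three vertices, so every dominating set of C_{3k}, in particular V, has at
-- least k elements.
module Submission where

open import Defs
open import Data.Bool using (Bool; true; false; not; _∨_)
open import Data.Empty using (⊥-elim)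
open import Data.Fin as Fin using (Fin; zero; suc; toℕ; splitAt; _↑ˡ_; _↑ʳ_)
open import Data.Fin.Properties using (toℕ-injective; toℕ<n; toℕ-fromℕ<; splitAt-↑ˡ; splitAt-↑ʳ)
open import Data.Fin.Subset using (Subset; _∈_; ∣_∣)
open import Data.List using (List; []; _∷_; length; filter; allFin; map)
open import Data.List.Properties using (map-tabulate)
open import Data.Nat using (ℕ; zero; suc; _+_; _*_; _≤_; _<_; _%_; z≤n; s≤s; NonZero)
open import Data.Nat.DivMod
  using (_mod_; _/_; m%n<n; m≡m%n+[m/n]*n; [m+kn]%n≡m%n; [m+n]%n≡m%n; m<n⇒m%n≡m; n%n≡0;
         %-remove-+ˡ; m∣n⇒o%n%m≡o%m)
open import Data.Nat.Divisibility using (∣-refl; m∣m*n)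
open import Data.Nat.ListAction using () renaming (sum to sumᴸ)
open import Data.Nat.Properties
open import Data.Nat.Tactic.RingSolver using (solve-∀)
open import Data.Product using (Σ; _×_; _,_)
open import Data.Sum using (_⊎_; inj₁; inj₂; [_,_]′)
open import Data.Vec using (lookup; tabulate)
open import Data.Vec.Properties using (lookup∘tabulate; lookup⇒[]=; []=⇒lookup)
open import Function using (_∘_)
open import Relation.Binary.PropositionalEquality
open import Relation.Nullary using (Dec; does; yes; no)
open import Relation.Nullary.Decidable using (dec-true; dec-false)
open import Algebra.Properties.CommutativeSemigroup +-commutativeSemigroup using (xy∙z≈xz∙y)
open import Algebra.Properties.Semiring.Sum +-*-semiring
  using (sum; sum-syntax; sum-cong-≗; sum-replicate-zero; ∑-comm; ∑-distrib-+; *-distribˡ-sum)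

𝟙 : Bool → ℕ
𝟙 true  = 1
𝟙 false = 0

1≤𝟙 : ∀ {b} → b ≡ true → 1 ≤ 𝟙 b
1≤𝟙 refl = ≤-refl

∑-mono-≤ : ∀ {m} {g h : Fin m → ℕ} → (∀ i → g i ≤ h i) → sum g ≤ sum h
∑-mono-≤ {zero}  _   = z≤n
∑-mono-≤ {suc m} g≤h = +-mono-≤ (g≤h zero) (∑-mono-≤ (g≤h ∘ suc))

∑-const-1 : ∀ m → ∑[ i < m ] 1 ≡ m
∑-const-1 zero    = refl
∑-const-1 (suc m) = cong suc (∑-const-1 m)

term≤∑ : ∀ {m} (g : Fin m → ℕ) i → g i ≤ sum g
term≤∑ g zero    = m≤m+n _ _
term≤∑ g (suc i) = ≤-trans (term≤∑ (g ∘ suc) i) (m≤n+m _ _)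

∑-↑ : ∀ m n (g : Fin (m + n) → ℕ) → sum g ≡ ∑[ i < m ] g (i ↑ˡ n) + ∑[ j < n ] g (m ↑ʳ j)
∑-↑ zero    n g = refl
∑-↑ (suc m) n g = trans (cong (g zero +_) (∑-↑ m n (g ∘ suc))) (sym (+-assoc (g zero) _ _))

∑-δ : ∀ {m} (w : Fin m → ℕ) a → ∑[ t < m ] (w t * 𝟙 (does (t Fin.≟ a))) ≡ w a
∑-δ {suc m} w zero = begin
  w zero * 1 + ∑[ t < m ] (w (suc t) * 0)  ≡⟨ cong₂ _+_ (*-identityʳ (w zero)) ∑0 ⟩
  w zero + 0                               ≡⟨ +-identityʳ (w zero) ⟩
  w zero                                   ∎
  where
  open ≡-Reasoning
  ∑0 : ∑[ t < m ] (w (suc t) * 0) ≡ 0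
  ∑0 = trans (sum-cong-≗ (λ t → *-zeroʳ (w (suc t)))) (sum-replicate-zero m)
∑-δ {suc m} w (suc a) = cong₂ _+_ (*-zeroʳ (w zero)) (∑-δ (w ∘ suc) a)

∑-𝟙-unique≤1 : ∀ {m} {P : Fin m → Set} (P? : ∀ i → Dec (P i))
  → (∀ {i j} → P i → P j → i ≡ j) → ∑[ i < m ] 𝟙 (does (P? i)) ≤ 1
∑-𝟙-unique≤1 {zero}  P? unique = z≤n
∑-𝟙-unique≤1 {suc m} P? unique with P? zero
... | yes p = ≤-reflexive (cong suc (trans (sum-cong-≗ none) (sum-replicate-zero m)))
  where
  none : ∀ i → 𝟙 (does (P? (suc i))) ≡ 0
  none i = cong 𝟙 (dec-false (P? (suc i)) (λ q → 0≢suc (unique p q)))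
    where
    0≢suc : zero ≢ suc i
    0≢suc ()
... | no _  = ∑-𝟙-unique≤1 (P? ∘ suc) (λ p q → Data.Fin.Properties.suc-injective (unique p q))

∑-preimage : ∀ {m k} (w : Fin m → ℕ) (f : Fin k → Fin m)
  → ∑[ t < m ] (w t * ∑[ u < k ] 𝟙 (does (t Fin.≟ f u))) ≡ ∑[ u < k ] w (f u)
∑-preimage {m} {k} w f = begin
  ∑[ t < m ] (w t * ∑[ u < k ] δ t u)  ≡⟨ sum-cong-≗ (λ t → *-distribˡ-sum (w t) (δ t)) ⟩
  ∑[ t < m ] ∑[ u < k ] (w t * δ t u)  ≡⟨ ∑-comm (λ t u → w t * δ t u) ⟩
  ∑[ u < k ] ∑[ t < m ] (w t * δ t u)  ≡⟨ sum-cong-≗ (λ u → ∑-δ w (f u)) ⟩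
  ∑[ u < k ] w (f u)                   ∎
  where
  open ≡-Reasoning
  δ : Fin m → Fin k → ℕ
  δ t u = 𝟙 (does (t Fin.≟ f u))

χ : ∀ {m} → Subset m → Fin m → ℕ
χ p i = 𝟙 (lookup p i)

∣p∣≡∑χ : ∀ {m} (p : Subset m) → ∣ p ∣ ≡ ∑[ i < m ] χ p i
∣p∣≡∑χ Data.Vec.[]          = refl
∣p∣≡∑χ (true Data.Vec.∷ p)  = cong suc (∣p∣≡∑χ p)
∣p∣≡∑χ (false Data.Vec.∷ p) = ∣p∣≡∑χ p

χ-tabulate : ∀ {m} (g : Fin m → Bool) i → χ (tabulate g) i ≡ 𝟙 (g i)
χ-tabulate g i = cong 𝟙 (lookup∘tabulate g i)

∈-tabulate⁺ : ∀ {m} {g : Fin m → Bool} {i} → g i ≡ true → i ∈ tabulate g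
∈-tabulate⁺ {g = g} {i} gi≡true = lookup⇒[]= i (tabulate g) (trans (lookup∘tabulate g i) gi≡true)

∑χ*≤*∣p∣ : ∀ {m} (p : Subset m) {g : Fin m → ℕ} {c}
  → (∀ i → g i ≤ c) → ∑[ i < m ] (χ p i * g i) ≤ c * ∣ p ∣
∑χ*≤*∣p∣ {m} p {g} {c} g≤c = begin
  ∑[ i < m ] (χ p i * g i)  ≤⟨ ∑-mono-≤ (λ i → *-monoʳ-≤ (χ p i) (g≤c i)) ⟩
  ∑[ i < m ] (χ p i * c)    ≡⟨ sum-cong-≗ (λ i → *-comm (χ p i) c) ⟩
  ∑[ i < m ] (c * χ p i)    ≡⟨ *-distribˡ-sum c (χ p) ⟨
  c * ∑[ i < m ] χ p i      ≡⟨ cong (c *_) (∣p∣≡∑χ p) ⟨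
  c * ∣ p ∣                 ∎
  where open ≤-Reasoning

length≡sum-𝟙 : ∀ {a p} {A : Set a} {P : A → Set p} (P? : ∀ x → Dec (P x)) (xs : List A)
  → length (filter P? xs) ≡ sumᴸ (map (𝟙 ∘ does ∘ P?) xs)
length≡sum-𝟙 P? []       = refl
length≡sum-𝟙 P? (x ∷ xs) with does (P? x)
... | true  = cong suc (length≡sum-𝟙 P? xs)
... | false = length≡sum-𝟙 P? xs

sum-map-filter : ∀ {a p} {A : Set a} {P : A → Set p} (P? : ∀ x → Dec (P x)) (g : A → ℕ) (xs : List A)
  → sumᴸ (map g (filter P? xs)) ≡ sumᴸ (map (λ x → 𝟙 (does (P? x)) * g x) xs)
sum-map-filter P? g []       = refl
sum-map-filter P? g (x ∷ xs) with does (P? x)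
... | true  = cong₂ _+_ (sym (+-identityʳ (g x))) (sum-map-filter P? g xs)
... | false = sum-map-filter P? g xs

sum-map-allFin : ∀ m (g : Fin m → ℕ) → sumᴸ (map g (allFin m)) ≡ sum g
sum-map-allFin m g = trans (cong sumᴸ (map-tabulate (λ i → i) g)) (sum-tabulate m g)
  where
  sum-tabulate : ∀ m (g : Fin m → ℕ) → sumᴸ (Data.List.tabulate g) ≡ sum g
  sum-tabulate zero    g = refl
  sum-tabulate (suc m) g = cong (g zero +_) (sum-tabulate m (g ∘ suc))

length-filter-allFin : ∀ {m} {P : Fin m → Set} (P? : ∀ t → Dec (P t))
  → length (filter P? (allFin m)) ≡ ∣ tabulate (does ∘ P?) ∣
length-filter-allFin {m} P? = begin
  length (filter P? (allFin m))          ≡⟨ length≡sum-𝟙 P? (allFin m) ⟩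
  sumᴸ (map (𝟙 ∘ does ∘ P?) (allFin m))  ≡⟨ sum-map-allFin m (𝟙 ∘ does ∘ P?) ⟩
  ∑[ t < m ] 𝟙 (does (P? t))             ≡⟨ sum-cong-≗ (χ-tabulate (does ∘ P?)) ⟨
  ∑[ t < m ] χ (tabulate (does ∘ P?)) t  ≡⟨ ∣p∣≡∑χ (tabulate (does ∘ P?)) ⟨
  ∣ tabulate (does ∘ P?) ∣               ∎
  where open ≡-Reasoning

sum-map-filter-allFin : ∀ {m} {P : Fin m → Set} (P? : ∀ t → Dec (P t)) (g : Fin m → ℕ)
  → sumᴸ (map g (filter P? (allFin m))) ≡ ∑[ t < m ] (χ (tabulate (does ∘ P?)) t * g t)
sum-map-filter-allFin {m} P? g = begin
  sumᴸ (map g (filter P? (allFin m)))                  ≡⟨ sum-map-filter P? g (allFin m) ⟩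
  sumᴸ (map (λ t → 𝟙 (does (P? t)) * g t) (allFin m))  ≡⟨ sum-map-allFin m _ ⟩
  ∑[ t < m ] (𝟙 (does (P? t)) * g t)                   ≡⟨ sum-cong-≗ (λ t → cong (_* g t) (χ-tabulate _ t)) ⟨
  ∑[ t < m ] (χ (tabulate (does ∘ P?)) t * g t)        ∎
  where open ≡-Reasoning

deg≡∑ : ∀ G v → deg G v ≡ ∑[ u < n G ] 𝟙 (does (adj? G v u))
deg≡∑ G v = trans (length≡sum-𝟙 (adj? G v) (allFin (n G))) (sum-map-allFin (n G) _)

-- Each vertex of D dominates at most Δ + 1 vertices: itself and its neighbours.
n≤[1+Δ]*∣D∣ : ∀ G {Δ} {D} → (∀ u → deg G u ≤ Δ) → Dominating G D → n G ≤ suc Δ * ∣ D ∣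
n≤[1+Δ]*∣D∣ G {Δ} {D} deg≤Δ dom = begin
  n G                                           ≡⟨ ∑-const-1 (n G) ⟨
  ∑[ v < n G ] 1                                ≤⟨ ∑-mono-≤ covered ⟩
  ∑[ v < n G ] ∑[ u < n G ] (χ D u * closed u v) ≡⟨ ∑-comm (λ v u → χ D u * closed u v) ⟩
  ∑[ u < n G ] ∑[ v < n G ] (χ D u * closed u v) ≡⟨ sum-cong-≗ (λ u → *-distribˡ-sum (χ D u) (closed u)) ⟨
  ∑[ u < n G ] (χ D u * ∑[ v < n G ] closed u v) ≡⟨ sum-cong-≗ (λ u → cong (χ D u *_) (closed-size u)) ⟩
  ∑[ u < n G ] (χ D u * suc (deg G u))           ≤⟨ ∑χ*≤*∣p∣ D (s≤s ∘ deg≤Δ) ⟩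
  suc Δ * ∣ D ∣                                 ∎
  where
  open ≤-Reasoning
  closed : Fin (n G) → Fin (n G) → ℕ
  closed u v = 𝟙 (does (v Fin.≟ u)) + 𝟙 (does (adj? G u v))

  closed-size : ∀ u → ∑[ v < n G ] closed u v ≡ suc (deg G u)
  closed-size u = trans (∑-distrib-+ (λ v → 𝟙 (does (v Fin.≟ u))) (λ v → 𝟙 (does (adj? G u v))))
                        (cong₂ _+_ self-count (sym (deg≡∑ G u)))
    where
    self-count : ∑[ v < n G ] 𝟙 (does (v Fin.≟ u)) ≡ 1
    self-count = trans (sum-cong-≗ (λ v → sym (*-identityˡ (𝟙 (does (v Fin.≟ u)))))) (∑-δ (λ _ → 1) u)

  1≤closed : ∀ {u v} → v ≡ u ⊎ Adj G u v → 1 ≤ closed u v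
  1≤closed {u} {v} (inj₁ v≡u) = ≤-trans (1≤𝟙 (dec-true (v Fin.≟ u) v≡u)) (m≤m+n _ _)
  1≤closed {u} {v} (inj₂ adj) = ≤-trans (1≤𝟙 (dec-true (adj? G u v) adj)) (m≤n+m _ _)

  dominator-term : ∀ {u v} → u ∈ D → v ≡ u ⊎ Adj G u v → 1 ≤ χ D u * closed u v
  dominator-term {u} {v} u∈D v∼u = begin
    1                   ≤⟨ 1≤closed v∼u ⟩
    closed u v          ≡⟨ *-identityˡ _ ⟨
    1 * closed u v      ≡⟨ cong (λ b → 𝟙 b * closed u v) ([]=⇒lookup u∈D) ⟨
    χ D u * closed u v  ∎

  covered : ∀ v → 1 ≤ ∑[ u < n G ] (χ D u * closed u v)
  covered v with dom v
  ... | inj₁ v∈D             = ≤-trans (dominator-term v∈D (inj₁ refl)) (term≤∑ _ v)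
  ... | inj₂ (u , u∈D , adj) = ≤-trans (dominator-term u∈D (inj₂ adj)) (term≤∑ _ u)

module _ (G : Graph) (f : Fin (n G) → Fin (n G)) where
  private
    N : ℕ
    N = n G

    F : Graph
    F = functigraph G f

  ∣f⁻¹∣ : Fin N → ℕ
  ∣f⁻¹∣ t = ∑[ u < N ] 𝟙 (does (t Fin.≟ f u))

  deg-↑ʳ : ∀ t → deg F (N ↑ʳ t) ≡ deg G t + ∣f⁻¹∣ t
  deg-↑ʳ t = begin
    deg F (N ↑ʳ t)                                 ≡⟨ deg≡∑ F (N ↑ʳ t) ⟩
    ∑[ y < N + N ] adjacency (splitAt N y)         ≡⟨ ∑-↑ N N (adjacency ∘ splitAt N) ⟩
    ∑[ u < N ] adjacency (splitAt N (u ↑ˡ N))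
      + ∑[ s < N ] adjacency (splitAt N (N ↑ʳ s))  ≡⟨ cong₂ _+_ (sum-cong-≗ in-G₁) (sum-cong-≗ in-G₂) ⟩
    ∣f⁻¹∣ t + ∑[ s < N ] 𝟙 (does (adj? G t s))     ≡⟨ +-comm (∣f⁻¹∣ t) _ ⟩
    ∑[ s < N ] 𝟙 (does (adj? G t s)) + ∣f⁻¹∣ t     ≡⟨ cong (_+ ∣f⁻¹∣ t) (deg≡∑ G t) ⟨
    deg G t + ∣f⁻¹∣ t                              ∎
    where
    open ≡-Reasoning
    adjacency : Fin N ⊎ Fin N → ℕ
    adjacency y = 𝟙 (does (fadj? G f (splitAt N (N ↑ʳ t)) y))

    in-G₁ : ∀ u → adjacency (splitAt N (u ↑ˡ N)) ≡ 𝟙 (does (t Fin.≟ f u))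
    in-G₁ u = cong₂ (λ x y → 𝟙 (does (fadj? G f x y))) (splitAt-↑ʳ N N t) (splitAt-↑ˡ N u N)

    in-G₂ : ∀ s → adjacency (splitAt N (N ↑ʳ s)) ≡ 𝟙 (does (adj? G t s))
    in-G₂ s = cong₂ (λ x y → 𝟙 (does (fadj? G f x y))) (splitAt-↑ʳ N N t) (splitAt-↑ʳ N N s)

  ∑-weighted-deg-↑ʳ : ∀ (w : Fin N → ℕ)
    → ∑[ t < N ] (w t * deg F (N ↑ʳ t)) ≡ ∑[ t < N ] (w t * deg G t) + ∑[ u < N ] w (f u)
  ∑-weighted-deg-↑ʳ w = begin
    ∑[ t < N ] (w t * deg F (N ↑ʳ t))                       ≡⟨ sum-cong-≗ split ⟩
    ∑[ t < N ] (w t * deg G t + w t * ∣f⁻¹∣ t)              ≡⟨ ∑-distrib-+ _ (λ t → w t * ∣f⁻¹∣ t) ⟩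
    ∑[ t < N ] (w t * deg G t) + ∑[ t < N ] (w t * ∣f⁻¹∣ t) ≡⟨ cong (_ +_) (∑-preimage w f) ⟩
    ∑[ t < N ] (w t * deg G t) + ∑[ u < N ] w (f u)         ∎
    where
    open ≡-Reasoning
    split : ∀ t → w t * deg F (N ↑ʳ t) ≡ w t * deg G t + w t * ∣f⁻¹∣ t
    split t = trans (cong (w t *_) (deg-↑ʳ t)) (*-distribˡ-+ (w t) (deg G t) (∣f⁻¹∣ t))

  liftᵇ : Subset N → Fin N ⊎ Fin N → Bool
  liftᵇ V = [ (λ u → not (lookup V (f u))) , lookup V ]′

  lift : Subset N → Subset (N + N)
  lift V = tabulate (liftᵇ V ∘ splitAt N)

  ∣lift∣ : ∀ V → ∣ lift V ∣ + ∑[ u < N ] χ V (f u) ≡ N + ∣ V ∣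
  ∣lift∣ V = begin
    ∣ lift V ∣ + A                                              ≡⟨ cong (_+ A) (∣p∣≡∑χ (lift V)) ⟩
    ∑[ y < N + N ] χ (lift V) y + A                             ≡⟨ cong (_+ A) (∑-↑ N N (χ (lift V))) ⟩
    ∑[ u < N ] χ (lift V) (u ↑ˡ N) + ∑[ t < N ] χ (lift V) (N ↑ʳ t) + A
      ≡⟨ cong (_+ A) (cong₂ _+_ (sum-cong-≗ in-G₁) (sum-cong-≗ in-G₂)) ⟩
    ∑[ u < N ] 𝟙 (not (lookup V (f u))) + ∑[ t < N ] χ V t + A  ≡⟨ xy∙z≈xz∙y _ (∑[ t < N ] χ V t) A ⟩
    ∑[ u < N ] 𝟙 (not (lookup V (f u))) + A + ∑[ t < N ] χ V t
      ≡⟨ cong₂ _+_ (∑-distrib-+ (λ u → 𝟙 (not (lookup V (f u)))) (χ V ∘ f)) (∣p∣≡∑χ V) ⟨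
    ∑[ u < N ] (𝟙 (not (lookup V (f u))) + χ V (f u)) + ∣ V ∣
      ≡⟨ cong (_+ ∣ V ∣) (trans (sum-cong-≗ (λ u → 𝟙-not+𝟙 (lookup V (f u)))) (∑-const-1 N)) ⟩
    N + ∣ V ∣
      ∎
    where
    open ≡-Reasoning
    A : ℕ
    A = ∑[ u < N ] χ V (f u)

    in-G₁ : ∀ u → χ (lift V) (u ↑ˡ N) ≡ 𝟙 (not (lookup V (f u)))
    in-G₁ u = trans (χ-tabulate _ (u ↑ˡ N)) (cong (𝟙 ∘ liftᵇ V) (splitAt-↑ˡ N u N))

    in-G₂ : ∀ t → χ (lift V) (N ↑ʳ t) ≡ χ V t
    in-G₂ t = trans (χ-tabulate _ (N ↑ʳ t)) (cong (𝟙 ∘ liftᵇ V) (splitAt-↑ʳ N N t))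

    𝟙-not+𝟙 : ∀ b → 𝟙 (not b) + 𝟙 b ≡ 1
    𝟙-not+𝟙 true  = refl
    𝟙-not+𝟙 false = refl

  ↑ʳ∈lift : ∀ {V t} → t ∈ V → N ↑ʳ t ∈ lift V
  ↑ʳ∈lift {V} {t} t∈V = ∈-tabulate⁺ (trans (cong (liftᵇ V) (splitAt-↑ʳ N N t)) ([]=⇒lookup t∈V))

  FAdj-↑ʳ : ∀ {t x} → FAdj G f (inj₂ t) x → FAdj G f (splitAt N (N ↑ʳ t)) x
  FAdj-↑ʳ {t} {x} = subst (λ s → FAdj G f s x) (sym (splitAt-↑ʳ N N t))

  lift-dominating : ∀ {V} → Dominating G V → Dominating F (lift V)
  lift-dominating {V} dom y = dominated (splitAt N y) refl
    where
    dominated : ∀ s → splitAt N y ≡ s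
      → (y ∈ lift V) ⊎ Σ (Fin (N + N)) (λ z → z ∈ lift V × FAdj G f (splitAt N z) s)
    dominated (inj₁ u) y≡u with lookup V (f u) in fu∈V
    ... | true  = inj₂ (N ↑ʳ f u , ↑ʳ∈lift (lookup⇒[]= (f u) V fu∈V) , FAdj-↑ʳ refl)
    ... | false = inj₁ (∈-tabulate⁺ (trans (cong (liftᵇ V) y≡u) (cong not fu∈V)))
    dominated (inj₂ t) y≡t with dom t
    ... | inj₁ t∈V             = inj₁ (∈-tabulate⁺ (trans (cong (liftᵇ V) y≡t) ([]=⇒lookup t∈V)))
    ... | inj₂ (s , s∈V , adj) = inj₂ (N ↑ʳ s , ↑ʳ∈lift s∈V , FAdj-↑ʳ adj)

  γ+∣f⁻¹V∣≤n+∣V∣ : ∀ {γ V} → (∀ D → Dominating F D → γ ≤ ∣ D ∣) → Dominating G V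
    → γ + ∑[ u < N ] χ V (f u) ≤ N + ∣ V ∣
  γ+∣f⁻¹V∣≤n+∣V∣ {V = V} γ-minimal V-dominating =
    ≤-trans (+-monoˡ-≤ _ (γ-minimal (lift V) (lift-dominating V-dominating))) (≤-reflexive (∣lift∣ V))

cycSucc-unique : ∀ m {u v w : Fin m} → CycSucc m u v → CycSucc m u w → v ≡ w
cycSucc-unique m (inj₁ u→v) (inj₁ u→w) = toℕ-injective (trans (sym u→v) u→w)
cycSucc-unique m {v = v} (inj₁ u→v) (inj₂ (u+1≡m , _)) =
  ⊥-elim (<-irrefl (trans (sym u→v) u+1≡m) (toℕ<n v))
cycSucc-unique m {w = w} (inj₂ (u+1≡m , _)) (inj₁ u→w) =
  ⊥-elim (<-irrefl (trans (sym u→w) u+1≡m) (toℕ<n w))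
cycSucc-unique m (inj₂ (_ , v≡0)) (inj₂ (_ , w≡0)) = toℕ-injective (trans v≡0 (sym w≡0))

cycPred-unique : ∀ m {u v w : Fin m} → CycSucc m v u → CycSucc m w u → v ≡ w
cycPred-unique m (inj₁ v→u) (inj₁ w→u) = toℕ-injective (suc-injective (trans v→u (sym w→u)))
cycPred-unique m (inj₁ v→u) (inj₂ (_ , u≡0)) = ⊥-elim (0≢1+n (trans (sym u≡0) (sym v→u)))
cycPred-unique m (inj₂ (_ , u≡0)) (inj₁ w→u) = ⊥-elim (0≢1+n (trans (sym u≡0) (sym w→u)))
cycPred-unique m (inj₂ (v+1≡m , _)) (inj₂ (w+1≡m , _)) =
  toℕ-injective (suc-injective (trans v+1≡m (sym w+1≡m)))

deg-cycle≤2 : ∀ m u → deg (cycle m) u ≤ 2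
deg-cycle≤2 m u = begin
  deg (cycle m) u                                 ≡⟨ deg≡∑ (cycle m) u ⟩
  ∑[ v < m ] 𝟙 (does (succ? v) ∨ does (pred? v))
    ≤⟨ ∑-mono-≤ (λ v → 𝟙-∨ (does (succ? v)) (does (pred? v))) ⟩
  ∑[ v < m ] (𝟙 (does (succ? v)) + 𝟙 (does (pred? v)))
    ≡⟨ ∑-distrib-+ (𝟙 ∘ does ∘ succ?) (𝟙 ∘ does ∘ pred?) ⟩
  ∑[ v < m ] 𝟙 (does (succ? v)) + ∑[ v < m ] 𝟙 (does (pred? v))
    ≤⟨ +-mono-≤ (∑-𝟙-unique≤1 succ? (cycSucc-unique m)) (∑-𝟙-unique≤1 pred? (cycPred-unique m)) ⟩
  2 ∎
  where
  open ≤-Reasoning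
  succ? : ∀ v → Dec (CycSucc m u v)
  succ? v = cycSucc? m u v

  pred? : ∀ v → Dec (CycSucc m v u)
  pred? v = cycSucc? m v u

  𝟙-∨ : ∀ a b → 𝟙 (a ∨ b) ≤ 𝟙 a + 𝟙 b
  𝟙-∨ true  b = s≤s z≤n
  𝟙-∨ false b = ≤-refl

module _ (m : ℕ) .{{_ : NonZero m}} where
  toℕ-mod : ∀ y → toℕ (y mod m) ≡ y % m
  toℕ-mod y = toℕ-fromℕ< (m%n<n y m)

  mod-toℕ : ∀ (t : Fin m) → toℕ t mod m ≡ t
  mod-toℕ t = toℕ-injective (trans (toℕ-mod (toℕ t)) (m<n⇒m%n≡m (toℕ<n t)))

  mod-periodic : ∀ y → (y + m) mod m ≡ y mod m
  mod-periodic y = toℕ-injective (trans (toℕ-mod (y + m)) (trans ([m+n]%n≡m%n y m) (sym (toℕ-mod y))))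

  [1+y]%m≡[1+y%m]%m : ∀ y → suc y % m ≡ suc (y % m) % m
  [1+y]%m≡[1+y%m]%m y =
    trans (cong (λ z → suc z % m) (m≡m%n+[m/n]*n y m)) ([m+kn]%n≡m%n (suc (y % m)) (y / m) m)

  mod-cycSucc : ∀ y → CycSucc m (y mod m) (suc y mod m)
  mod-cycSucc y with m≤n⇒m<n∨m≡n (m%n<n y m)
  ... | inj₁ 1+y%m<m = inj₁ (begin
    suc (toℕ (y mod m))  ≡⟨ cong suc (toℕ-mod y) ⟩
    suc (y % m)          ≡⟨ m<n⇒m%n≡m 1+y%m<m ⟨
    suc (y % m) % m      ≡⟨ [1+y]%m≡[1+y%m]%m y ⟨
    suc y % m            ≡⟨ toℕ-mod (suc y) ⟨
    toℕ (suc y mod m)    ∎)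
    where open ≡-Reasoning
  ... | inj₂ 1+y%m≡m = inj₂ (trans (cong suc (toℕ-mod y)) 1+y%m≡m , (begin
    toℕ (suc y mod m)    ≡⟨ toℕ-mod (suc y) ⟩
    suc y % m            ≡⟨ [1+y]%m≡[1+y%m]%m y ⟩
    suc (y % m) % m      ≡⟨ cong (_% m) 1+y%m≡m ⟩
    m % m                ≡⟨ n%n≡0 m ⟩
    0                    ∎))
    where open ≡-Reasoning

residue-cover : ∀ x (r : Fin 3) → x % 3 ≡ toℕ r ⊎ suc x % 3 ≡ toℕ r ⊎ (2 + x) % 3 ≡ toℕ r
residue-cover zero zero             = inj₁ refl
residue-cover zero (suc zero)       = inj₂ (inj₁ refl)
residue-cover zero (suc (suc zero)) = inj₂ (inj₂ refl)
residue-cover (suc x) r with residue-cover x r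
... | inj₁ x≡r          = inj₂ (inj₂ (trans (%-remove-+ˡ {3} x ∣-refl) x≡r))
... | inj₂ (inj₁ 1+x≡r) = inj₁ 1+x≡r
... | inj₂ (inj₂ 2+x≡r) = inj₂ (inj₁ 2+x≡r)

residueClass : ∀ k → Fin 3 → Subset (3 * k)
residueClass k r = tabulate (λ t → does (toℕ t % 3 ≟ toℕ r))

∈residueClass : ∀ {k r} {t : Fin (3 * k)} → toℕ t % 3 ≡ toℕ r → t ∈ residueClass k r
∈residueClass {r = r} {t} t≡r =
  ∈-tabulate⁺ {g = λ s → does (toℕ s % 3 ≟ toℕ r)} (dec-true (toℕ t % 3 ≟ toℕ r) t≡r)

-- The vertices t - 1, t, t + 1 have distinct residues modulo 3, also across the wrap-around,
-- because 3 divides the length of the cycle.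
residueClass-dominating : ∀ k r → Dominating (cycle (3 * k)) (residueClass k r)
residueClass-dominating (suc k) r t = dominated (residue-cover (toℕ t) r)
  where
  M : ℕ
  M = 3 * suc k

  ∈class : ∀ {s} y → y % 3 ≡ toℕ r → y mod M ≡ s → s ∈ residueClass (suc k) r
  ∈class y y≡r refl = ∈residueClass {suc k} (begin
    toℕ (y mod M) % 3  ≡⟨ cong (_% 3) (toℕ-mod M y) ⟩
    y % M % 3          ≡⟨ m∣n⇒o%n%m≡o%m 3 M y (m∣m*n (suc k)) ⟩
    y % 3              ≡⟨ y≡r ⟩
    toℕ r              ∎)
    where open ≡-Reasoning

  -- toℕ t + M - 1, written without truncated subtraction
  prev : ℕ
  prev = 2 + toℕ t + k * 3

  prev↦t : suc prev mod M ≡ t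
  prev↦t = begin
    suc prev mod M     ≡⟨ cong (_mod M) (shift (toℕ t) k) ⟩
    (toℕ t + M) mod M  ≡⟨ mod-periodic M (toℕ t) ⟩
    toℕ t mod M        ≡⟨ mod-toℕ M t ⟩
    t                  ∎
    where
    open ≡-Reasoning
    shift : ∀ x k → suc (2 + x + k * 3) ≡ x + 3 * suc k
    shift = solve-∀

  dominated : toℕ t % 3 ≡ toℕ r ⊎ suc (toℕ t) % 3 ≡ toℕ r ⊎ (2 + toℕ t) % 3 ≡ toℕ r
    → t ∈ residueClass (suc k) r ⊎ Σ (Fin M) (λ s → s ∈ residueClass (suc k) r × Adj (cycle M) s t)
  dominated (inj₁ t≡r) = inj₁ (∈residueClass {suc k} t≡r)
  dominated (inj₂ (inj₁ 1+t≡r)) = inj₂ (suc (toℕ t) mod M , ∈class (suc (toℕ t)) 1+t≡r refl ,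
    inj₂ (subst (λ s → CycSucc M s (suc (toℕ t) mod M)) (mod-toℕ M t) (mod-cycSucc M (toℕ t))))
  dominated (inj₂ (inj₂ 2+t≡r)) = inj₂ (prev mod M , ∈class prev prev≡r refl ,
    inj₁ (subst (CycSucc M (prev mod M)) prev↦t (mod-cycSucc M prev)))
    where
    prev≡r : prev % 3 ≡ toℕ r
    prev≡r = trans ([m+kn]%n≡m%n (2 + toℕ t) k 3) 2+t≡r

γ<2c : ∀ {γ a l k c} → γ + a ≤ 3 * k + l → 4 * l < 2 * l + a → k ≤ l → k ≤ c → γ < 2 * c
γ<2c {γ} {a} {l} {k} {c} γ+a≤3k+l 4l<2l+a k≤l k≤c =
  ≤-trans (+-cancelʳ-≤ k (suc γ) (2 * k) (+-cancelʳ-≤ l (suc γ + k) (2 * k + k) chain)) (*-monoʳ-≤ 2 k≤c)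
  where
  2l<a : 2 * l < a
  2l<a = +-cancelˡ-< (2 * l) (2 * l) a (subst (_< 2 * l + a) (*-distribʳ-+ l 2 2) 4l<2l+a)

  regroup₁ : ∀ γ l → suc γ + l + l ≡ γ + suc (2 * l)
  regroup₁ = solve-∀

  regroup₂ : ∀ k l → 3 * k + l ≡ 2 * k + k + l
  regroup₂ = solve-∀

  chain : suc γ + k + l ≤ 2 * k + k + l
  chain = begin
    suc γ + k + l    ≤⟨ +-monoˡ-≤ l (+-monoʳ-≤ (suc γ) k≤l) ⟩
    suc γ + l + l    ≡⟨ regroup₁ γ l ⟩
    γ + suc (2 * l)  ≤⟨ +-monoʳ-≤ γ 2l<a ⟩
    γ + a            ≤⟨ γ+a≤3k+l ⟩
    3 * k + l        ≡⟨ regroup₂ k l ⟩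
    2 * k + k + l    ∎
    where open ≤-Reasoning

proposition4p17 : (k : ℕ) → 1 ≤ k → (f : Fin (3 * k) → Fin (3 * k))
    → Σ (Fin 3) (λ r → 4 * length (Vclass k r) < degSumV k f r)
    → (γF γC : ℕ)
    → IsDominationNumber (functigraph (cycle (3 * k)) f) γF
    → IsDominationNumber (cycle (3 * k)) γC
    → γF < 2 * γC
proposition4p17 k _ f (r , 4L<degSum) γF γC (_ , γF-minimal) ((C , C-dominating , refl) , _) =
  γ<2c (γ+∣f⁻¹V∣≤n+∣V∣ Cₘ f γF-minimal V-dominating) 4L<2L+A
       (one-third V-dominating) (one-third C-dominating)
  where
  Cₘ : Graph
  Cₘ = cycle (3 * k)

  V : Subset (3 * k)
  V = residueClass k r

  V-dominating : Dominating Cₘ V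
  V-dominating = residueClass-dominating k r

  one-third : ∀ {D} → Dominating Cₘ D → k ≤ ∣ D ∣
  one-third dom = *-cancelˡ-≤ 3 (n≤[1+Δ]*∣D∣ Cₘ (deg-cycle≤2 (3 * k)) dom)

  residue? : ∀ (t : Fin (3 * k)) → Dec (toℕ t % 3 ≡ toℕ r)
  residue? t = toℕ t % 3 ≟ toℕ r

  4L<2L+A : 4 * ∣ V ∣ < 2 * ∣ V ∣ + ∑[ u < 3 * k ] χ V (f u)
  4L<2L+A = begin-strict
    4 * ∣ V ∣                                              ≡⟨ cong (4 *_) (length-filter-allFin residue?) ⟨
    4 * length (Vclass k r)                                <⟨ 4L<degSum ⟩
    degSumV k f r                                          ≡⟨ sum-map-filter-allFin residue? _ ⟩
    ∑[ t < 3 * k ] (χ V t * deg (functigraph Cₘ f) (3 * k ↑ʳ t)) ≡⟨ ∑-weighted-deg-↑ʳ Cₘ f (χ V) ⟩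
    ∑[ t < 3 * k ] (χ V t * deg Cₘ t) + ∑[ u < 3 * k ] χ V (f u)
      ≤⟨ +-monoˡ-≤ _ (∑χ*≤*∣p∣ V (deg-cycle≤2 (3 * k))) ⟩
    2 * ∣ V ∣ + ∑[ u < 3 * k ] χ V (f u)                   ∎
    where open ≤-Reasoning
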